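{- Let $k\ge2$ be an integer. Then the greedy representation of $k$ with respect to the sequence $F_2,F_3,F_4,\ldots=2,3,5,\ldots$ has the minimum number of summands among all representations of $k$ with respect to this sequence.
   Context: $(F_n)_{n\ge0}$ is the Fibonacci sequence with $F_0=F_1=1$, $F_{n+1}=F_n+F_{n-1}$. A representation of a positive integer $k$ with respect to $F_2,F_3,\ldots$ is a finite multiset of terms $F_j$ ($j\ge2$) summing to $k$; its number of summands is the size of the multiset (with multiplicity). The greedy representation of $k\ge 2$ is obtained by processing the terms $F_j\le k$ in decreasing order of $j$: for the current $F_j$, take $F_j$ the largest number $q\ge0$ of times such that the remainder $k-qF_j$ is $0$ or at least $2$, then replace $k$ by the remainder and continue with $F_{j-1}$, until the remainder is $0$. -}

module Defs where

open import Data.Nat using (ℕ; zero; suc; _+_; _*_; _∸_; _≤_; _≤ᵇ_)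
open import Data.Bool using (Bool; true; false; if_then_else_; _∧_)
open import Data.List using (List; []; _∷_; _++_; replicate; map; length)
open import Data.Nat.ListAction using (sum)
open import Data.Product using (_×_)
open import Data.List.Relation.Unary.All using (All)
open import Relation.Binary.PropositionalEquality using (_≡_)

F : ℕ → ℕ
F zero = 1
F (suc zero) = 1
F (suc (suc n)) = F (suc n) + F n

-- A representation of k: a finite multiset of indices j ≥ 2 (as a list,
-- order irrelevant) with  Σ F j = k.  Number of summands = length.
IsRep : ℕ → List ℕ → Set
IsRep k js = All (λ j → 2 ≤ j) js × (sum (map F js) ≡ k)

okRem : ℕ → Bool
okRem zero = true
okRem (suc zero) = false
okRem (suc (suc _)) = true

bestQ : ℕ → ℕ → ℕ → ℕ
bestQ r f zero = 0
bestQ r f (suc b) =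
  if ((suc b * f) ≤ᵇ r) ∧ okRem (r ∸ suc b * f) then suc b else bestQ r f b

greedyFrom : ℕ → ℕ → List ℕ
greedyFrom r zero = []
greedyFrom r (suc zero) = []
greedyFrom r (suc (suc i)) =
  let j = suc (suc i) ; q = bestQ r (F j) r in
  replicate q j ++ greedyFrom (r ∸ q * F j) (suc i)

-- largest j ≥ 2 with F j ≤ k, searched below bound (F j ≥ j for j ≥ 2,
-- so bound k suffices); returns 1 if none
topIndex : ℕ → ℕ → ℕ
topIndex k zero = 1
topIndex k (suc zero) = 1
topIndex k (suc (suc i)) = if F (suc (suc i)) ≤ᵇ k then suc (suc i) else topIndex k (suc i)

greedy : ℕ → List ℕ
greedy k = greedyFrom k (topIndex k k)

-- Write G k for the length of the greedy representation of k. If F A is the largest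
-- term not exceeding k and k = F A + u, the greedy takes F A and continues with u,
-- except for u = 1, where it uses F A + 1 = F (A - 1) + (F (A - 2) + 1). From these
-- two recurrences, strong induction on k gives G (F t + s) ≤ 1 + G s for every term
-- F t (t ≥ 2) and every s ≠ 1, the remainders admitting a representation. Peeling the
-- summands off an arbitrary representation one at a time then bounds G k by its length.

module Submission where

open import Defs
open import Data.Bool using (true; false; if_then_else_)
open import Data.Empty using (⊥-elim)
open import Data.List using (List; []; _∷_; map; length)
open import Data.List.Relation.Unary.All using (All; []; _∷_)
open import Data.Nat
  using (ℕ; zero; suc; _+_; _*_; _∸_; _≤_; _<_; _≤′_; ≤′-refl; ≤′-step; _≤ᵇ_; z≤n; s≤s; z<s; _≟_)
open import Data.Nat.Induction using (<-rec)
open import Data.Nat.ListAction using (sum)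
open import Data.Nat.Properties
open import Algebra.Properties.CommutativeSemigroup +-commutativeSemigroup
  using (x∙yz≈y∙xz; xy∙z≈y∙xz)
open import Data.Product using (_×_; _,_; proj₁; proj₂)
open import Data.Sum using (inj₁; inj₂)
open import Relation.Binary.PropositionalEquality
open import Relation.Nullary using (¬_; Dec; yes; no)
open import Relation.Nullary.Reflects using (Reflects; ofʸ; ofⁿ)

private
  variable
    a b i j m n r s t u : ℕ

≥2⇒≢1 : 2 ≤ n → n ≢ 1
≥2⇒≢1 (s≤s ()) refl

F-positive : ∀ n → 0 < F n
F-positive zero = z<s
F-positive (suc zero) = z<s
F-positive (suc (suc n)) = <-≤-trans (F-positive (suc n)) (m≤m+n _ _)

F-<-suc : ∀ n → F (suc n) < F (2 + n)
F-<-suc n = m<m+n (F (suc n)) (F-positive n)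

F-≤-suc : ∀ n → F n ≤ F (suc n)
F-≤-suc zero = ≤-refl
F-≤-suc (suc n) = <⇒≤ (F-<-suc n)

F-mono-≤ : m ≤ n → F m ≤ F n
F-mono-≤ m≤n = go (≤⇒≤′ m≤n)
  where
  go : m ≤′ n → F m ≤ F n
  go ≤′-refl = ≤-refl
  go (≤′-step {n} m≤′n) = ≤-trans (go m≤′n) (F-≤-suc n)

F-mono-< : 1 ≤ m → m < n → F m < F n
F-mono-< {suc m} _ m<n = <-≤-trans (F-<-suc m) (F-mono-≤ m<n)

n<F[1+n] : ∀ n → n < F (suc n)
n<F[1+n] zero = z<s
n<F[1+n] (suc n) = ≤-<-trans (n<F[1+n] n) (F-<-suc n)

F-index-≤ : ∀ m → F m ≤ r → r < F (suc n) → m ≤ n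
F-index-≤ _ Fm≤r r<F = ≮⇒≥ λ n<m → <⇒≱ r<F (≤-trans (F-mono-≤ n<m) Fm≤r)

okRem-≢1 : u ≢ 1 → okRem u ≡ true
okRem-≢1 {zero} _ = refl
okRem-≢1 {suc zero} u≢1 = ⊥-elim (u≢1 refl)
okRem-≢1 {suc (suc u)} _ = refl

bestQ-< : ∀ {f} → r < f → ∀ b → bestQ r f b ≡ 0
bestQ-< r<f zero = refl
bestQ-< {r} {f} r<f (suc b) with suc b * f ≤ᵇ r | ≤ᵇ-reflects-≤ (suc b * f) r
... | true | ofʸ le = ⊥-elim (<⇒≱ r<f (≤-trans (m≤m+n f (b * f)) le))
... | false | _ = bestQ-< r<f b

bestQ-<-double : ∀ {f} → r < f + f → ∀ b → bestQ r f (suc b) ≡ bestQ r f 1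
bestQ-<-double r<2f zero = refl
bestQ-<-double {r} {f} r<2f (suc b) with suc (suc b) * f ≤ᵇ r | ≤ᵇ-reflects-≤ (suc (suc b) * f) r
... | true | ofʸ le = ⊥-elim (<⇒≱ r<2f (≤-trans (+-monoʳ-≤ f (m≤m+n f (b * f))) le))
... | false | _ = bestQ-<-double r<2f b

bestQ-once : ∀ f u → bestQ (f + u) f 1 ≡ (if okRem u then 1 else 0)
bestQ-once f u rewrite +-identityʳ f | m+n∸m≡n f u with f ≤ᵇ f + u | ≤ᵇ-reflects-≤ f (f + u)
... | true | _ = refl
... | false | ofⁿ ¬le = ⊥-elim (¬le (m≤m+n f u))

bestQ-single : ∀ {f} → u < f → bestQ (f + u) f (f + u) ≡ (if okRem u then 1 else 0)
bestQ-single {u} {suc f} u<f = trans (bestQ-<-double (+-monoʳ-< (suc f) u<f) (f + u)) (bestQ-once (suc f) u)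

greedyFrom-take : u < F (2 + a) → u ≢ 1 →
  greedyFrom (F (2 + a) + u) (2 + a) ≡ (2 + a) ∷ greedyFrom u (suc a)
greedyFrom-take {u} {a} u<F u≢1
  rewrite bestQ-single u<F | okRem-≢1 u≢1 | +-identityʳ (F (2 + a)) | m+n∸m≡n (F (2 + a)) u = refl

greedyFrom-skip-one : greedyFrom (F (2 + a) + 1) (2 + a) ≡ greedyFrom (F (2 + a) + 1) (suc a)
greedyFrom-skip-one {a} rewrite bestQ-single {1} {F (2 + a)} (F-mono-≤ (m≤m+n 2 a)) = refl

greedyFrom-below : r < F (suc i) → greedyFrom r (suc i) ≡ greedyFrom r i
greedyFrom-below {i = zero} _ = refl
greedyFrom-below {r} {suc i} r<F rewrite bestQ-< r<F r = refl

greedyFrom-lower : r < F (suc j) → j ≤ i → greedyFrom r i ≡ greedyFrom r j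
greedyFrom-lower {r} {j} r<F j≤i = go (≤⇒≤′ j≤i)
  where
  go : j ≤′ i → greedyFrom r i ≡ greedyFrom r j
  go ≤′-refl = refl
  go (≤′-step {i} j≤′i) =
    trans (greedyFrom-below {i = i} (<-≤-trans r<F (F-mono-≤ (s≤s (≤′⇒≤ j≤′i))))) (go j≤′i)

IsTopIndex : ℕ → ℕ → Set
IsTopIndex r J = 2 ≤ J × F J ≤ r × r < F (suc J)

topIndex-if : ∀ {J b} → Reflects (F (2 + i) ≤ r) b → r < F (3 + i) →
  (¬ F (2 + i) ≤ r → IsTopIndex r J) → IsTopIndex r (if b then 2 + i else J)
topIndex-if (ofʸ F≤r) r<F _ = s≤s (s≤s z≤n) , F≤r , r<F
topIndex-if (ofⁿ F≰r) _ below = below F≰r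

topIndex-spec : ∀ r i → 2 ≤ r → r < F (suc i) → IsTopIndex r (topIndex r i)
topIndex-spec r zero 2≤r r<F = ⊥-elim (<⇒≱ r<F (≤-trans (s≤s z≤n) 2≤r))
topIndex-spec r (suc zero) 2≤r r<F = ⊥-elim (<⇒≱ r<F 2≤r)
topIndex-spec r (suc (suc i)) 2≤r r<F =
  topIndex-if (≤ᵇ-reflects-≤ (F (2 + i)) r) r<F (λ F≰r → topIndex-spec r (suc i) 2≤r (≰⇒> F≰r))

greedyFrom-zero : ∀ i → greedyFrom 0 i ≡ []
greedyFrom-zero i = greedyFrom-lower {j = 0} {i = i} z<s z≤n

greedyFrom≡greedy : ∀ i → r ≢ 1 → r < F (suc i) → greedyFrom r i ≡ greedy r
greedyFrom≡greedy {zero} i _ _ = greedyFrom-zero i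
greedyFrom≡greedy {suc zero} i r≢1 _ = ⊥-elim (r≢1 refl)
greedyFrom≡greedy {r@(suc (suc _))} i _ r<F with topIndex-spec r r (s≤s (s≤s z≤n)) (n<F[1+n] r)
... | _ , F≤r , r<F′ = greedyFrom-lower {i = i} r<F′ (F-index-≤ (topIndex r r) F≤r r<F)

2≤F+1 : ∀ n → 2 ≤ F n + 1
2≤F+1 n = +-monoˡ-≤ 1 (F-positive n)

greedy-F+ : ∀ a → u < F (suc a) → u ≢ 1 → greedy (F (2 + a) + u) ≡ (2 + a) ∷ greedy u
greedy-F+ {u} a u<F u≢1 = begin
  greedy (F (2 + a) + u)             ≡⟨ greedyFrom≡greedy (2 + a) x≢1 x<F ⟨
  greedyFrom (F (2 + a) + u) (2 + a) ≡⟨ greedyFrom-take u<F′ u≢1 ⟩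
  (2 + a) ∷ greedyFrom u (suc a)     ≡⟨ cong ((2 + a) ∷_) (greedyFrom≡greedy (suc a) u≢1 u<F′) ⟩
  (2 + a) ∷ greedy u                 ∎
  where
  open ≡-Reasoning
  x≢1 : F (2 + a) + u ≢ 1
  x≢1 = ≥2⇒≢1 (≤-trans (F-mono-≤ (m≤m+n 2 a)) (m≤m+n _ u))
  x<F : F (2 + a) + u < F (3 + a)
  x<F = +-monoʳ-< (F (2 + a)) u<F
  u<F′ : u < F (2 + a)
  u<F′ = <-≤-trans u<F (F-≤-suc (suc a))

greedy-F+1 : ∀ b → greedy (F (3 + b) + 1) ≡ (2 + b) ∷ greedy (F (suc b) + 1)
greedy-F+1 zero = refl
greedy-F+1 (suc zero) = refl
greedy-F+1 b@(suc (suc c)) = begin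
  greedy (F (3 + b) + 1)                           ≡⟨ greedyFrom≡greedy (3 + b) x≢1 x<F ⟨
  greedyFrom (F (3 + b) + 1) (3 + b)               ≡⟨ greedyFrom-skip-one {suc b} ⟩
  greedyFrom (F (3 + b) + 1) (2 + b)               ≡⟨ cong (λ r → greedyFrom r (2 + b)) x≡ ⟩
  greedyFrom (F (2 + b) + (F (suc b) + 1)) (2 + b) ≡⟨ greedyFrom-take tail<F tail≢1 ⟩
  (2 + b) ∷ greedyFrom (F (suc b) + 1) (suc b)     ≡⟨ cong ((2 + b) ∷_) (greedyFrom≡greedy (suc b) tail≢1 tail<F) ⟩
  (2 + b) ∷ greedy (F (suc b) + 1)                 ∎
  where
  open ≡-Reasoning
  x≢1 : F (3 + b) + 1 ≢ 1
  x≢1 = ≥2⇒≢1 (2≤F+1 (3 + b))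
  x<F : F (3 + b) + 1 < F (4 + b)
  x<F = +-monoʳ-< (F (3 + b)) (F-mono-≤ (m≤m+n 2 b))
  x≡ : F (3 + b) + 1 ≡ F (2 + b) + (F (suc b) + 1)
  x≡ = +-assoc (F (2 + b)) (F (suc b)) 1
  tail<F : F (suc b) + 1 < F (2 + b)
  tail<F = +-monoʳ-< (F (suc b)) (F-mono-≤ (m≤m+n 2 c))
  tail≢1 : F (suc b) + 1 ≢ 1
  tail≢1 = ≥2⇒≢1 (2≤F+1 (suc b))

data LeadingForm : ℕ → Set where
  leading : ∀ a u → u < F (suc a) → LeadingForm (F (2 + a) + u)

leadingForm : 2 ≤ r → LeadingForm r
leadingForm {r} 2≤r with topIndex r r | topIndex-spec r r 2≤r (n<F[1+n] r)
... | zero | () , _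
... | suc zero | s≤s () , _
... | suc (suc a) | _ , F≤r , r<F = subst LeadingForm (m+[n∸m]≡n F≤r) (leading a (r ∸ F (2 + a)) rest<F)
  where
  rest<F : r ∸ F (2 + a) < F (suc a)
  rest<F = subst (r ∸ F (2 + a) <_) (m+n∸m≡n (F (2 + a)) (F (suc a))) (∸-monoˡ-< r<F F≤r)

IsRep-∷ : ∀ {js} → 2 ≤ t → IsRep r js → IsRep (F t + r) (t ∷ js)
IsRep-∷ {t} 2≤t (all≥2 , sum≡r) = 2≤t ∷ all≥2 , cong (F t +_) sum≡r

greedy-isRep : ∀ r → r ≢ 1 → IsRep r (greedy r)
greedy-isRep = <-rec (λ r → r ≢ 1 → IsRep r (greedy r)) step
  where
  step : ∀ r → (∀ {y} → y < r → y ≢ 1 → IsRep y (greedy y)) → r ≢ 1 → IsRep r (greedy r)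
  step zero _ _ = [] , refl
  step (suc zero) _ r≢1 = ⊥-elim (r≢1 refl)
  step r@(suc (suc _)) rec _ = fromLeading (leadingForm (s≤s (s≤s z≤n))) rec
    where
    fromLeading : ∀ {x} → LeadingForm x → (∀ {y} → y < x → y ≢ 1 → IsRep y (greedy y)) →
      IsRep x (greedy x)
    fromLeading (leading a u u<F) rec′ with u ≟ 1
    ... | no u≢1 rewrite greedy-F+ a u<F u≢1 =
      IsRep-∷ (m≤m+n 2 a) (rec′ (m<n+m u (F-positive (2 + a))) u≢1)
    fromLeading (leading zero _ (s≤s ())) _ | yes refl
    fromLeading (leading (suc b) _ _) rec′ | yes refl rewrite greedy-F+1 b =
      subst (λ z → IsRep z ((2 + b) ∷ greedy (F (suc b) + 1))) (sym (+-assoc (F (2 + b)) (F (suc b)) 1))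
        (IsRep-∷ (m≤m+n 2 b) (rec′ y<x (≥2⇒≢1 (2≤F+1 (suc b)))))
      where
      y<x : F (suc b) + 1 < F (3 + b) + 1
      y<x = +-monoˡ-< 1 (m<n+m (F (suc b)) (F-positive (2 + b)))

greedySize : ℕ → ℕ
greedySize k = length (greedy k)

greedySize-F+ : ∀ a → u < F (suc a) → u ≢ 1 → greedySize (F (2 + a) + u) ≡ suc (greedySize u)
greedySize-F+ a u<F u≢1 = cong length (greedy-F+ a u<F u≢1)

greedySize-F+1 : ∀ b → greedySize (F (3 + b) + 1) ≡ suc (greedySize (F (suc b) + 1))
greedySize-F+1 b = cong length (greedy-F+1 b)

greedySize-F+1-suc : ∀ n → greedySize (F n + 1) ≤ greedySize (F (suc n) + 1)
greedySize-F+1-suc 0 = ≤-refl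
greedySize-F+1-suc 1 = ≤-refl
greedySize-F+1-suc 2 = s≤s z≤n
greedySize-F+1-suc (suc (suc (suc b))) = begin
  greedySize (F (3 + b) + 1)           ≡⟨ greedySize-F+1 b ⟩
  suc (greedySize (F (suc b) + 1))     ≤⟨ s≤s (greedySize-F+1-suc (suc b)) ⟩
  suc (greedySize (F (2 + b) + 1))     ≡⟨ greedySize-F+1 (suc b) ⟨
  greedySize (F (4 + b) + 1)           ∎
  where open ≤-Reasoning

greedySize-F+1-mono : m ≤ n → greedySize (F m + 1) ≤ greedySize (F n + 1)
greedySize-F+1-mono m≤n = go (≤⇒≤′ m≤n)
  where
  go : m ≤′ n → greedySize (F m + 1) ≤ greedySize (F n + 1)
  go ≤′-refl = ≤-refl
  go (≤′-step {n} m≤′n) = ≤-trans (go m≤′n) (greedySize-F+1-suc n)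

SummandBound : ℕ → Set
SummandBound x = ∀ t s → 2 ≤ t → s ≢ 1 → F t + s ≡ x → greedySize x ≤ suc (greedySize s)

SummandBoundBelow : ℕ → Set
SummandBoundBelow x = ∀ {y} → y < x → SummandBound y

cancel-inner : ∀ m n {s w} → m + s ≡ n + (m + w) → s ≡ n + w
cancel-inner m n {s} {w} eq = +-cancelˡ-≡ m s (n + w) (trans eq (x∙yz≈y∙xz n m w))

remainder-≥ : ∀ {k v y} → m + v ≡ y → m + k ≤ y → k ≤ v
remainder-≥ {m} refl m+k≤y = +-cancelˡ-≤ m _ _ m+k≤y

remainder-< : ∀ {k v y} → m + v ≡ y → y < m + k → v < k
remainder-< {m} refl y<m+k = +-cancelˡ-< m _ _ y<m+k

greedySize-≤-F+ : ∀ j → 2 ≤ u → u < F (suc j) → SummandBound u → greedySize u ≤ greedySize (F j + u)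
greedySize-≤-F+ {suc zero} _ (s≤s ()) _ _
greedySize-≤-F+ zero (s≤s (s≤s _)) (s≤s ()) _
greedySize-≤-F+ (suc zero) (s≤s (s≤s _)) (s≤s (s≤s ())) _
greedySize-≤-F+ {2} (suc (suc zero)) _ _ _ = s≤s z≤n
greedySize-≤-F+ {suc (suc (suc _))} (suc (suc zero)) _ (s≤s (s≤s (s≤s ()))) _
greedySize-≤-F+ {u} (suc (suc (suc i))) 2≤u u<F bound with F (2 + i) ≤? u
... | no F≰u = ≤-trans (n≤1+n _) (≤-reflexive (sym (greedySize-F+ (suc i) (≰⇒> F≰u) (≥2⇒≢1 2≤u))))
... | yes F≤u with m≤n⇒∃[o]m+o≡n F≤u
...   | w , refl =
  subst (λ z → greedySize (F (2 + i) + w) ≤ greedySize z) (+-assoc (F (3 + i)) (F (2 + i)) w) (by-w (w ≟ 1))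
  where
  w<F : w < F (3 + i)
  w<F = +-cancelˡ-< (F (2 + i)) _ _ (<-≤-trans u<F (≤-reflexive (+-comm (F (3 + i)) (F (2 + i)))))
  by-w : Dec (w ≡ 1) → greedySize (F (2 + i) + w) ≤ greedySize (F (4 + i) + w)
  by-w (yes refl) = ≤-trans (n≤1+n _) (≤-reflexive (sym (greedySize-F+1 (suc i))))
  by-w (no w≢1) =
    ≤-trans (bound (2 + i) w (m≤m+n 2 i) w≢1 refl) (≤-reflexive (sym (greedySize-F+ (2 + i) w<F w≢1)))

summandBound-one-below : ∀ b → 2 ≤ t → t ≤ b → F t + s ≡ F (3 + b) + 1 →
  SummandBoundBelow (F (3 + b) + 1) → greedySize (F (suc b) + 1) ≤ greedySize s
summandBound-one-below {t} {s} b 2≤t t≤b eq rec = begin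
  greedySize (F (suc b) + 1) ≤⟨ rec y<x t v 2≤t v≢1 Ft+v≡y ⟩
  suc (greedySize v)         ≡⟨ greedySize-F+ b v<F v≢1 ⟨
  greedySize (F (2 + b) + v) ≡⟨ cong greedySize s≡ ⟨
  greedySize s               ∎
  where
  open ≤-Reasoning
  Ft<F : F t < F (suc b)
  Ft<F = F-mono-< (≤-trans (s≤s z≤n) 2≤t) (s≤s t≤b)
  v = proj₁ (m≤n⇒∃[o]m+o≡n (≤-trans (<⇒≤ Ft<F) (m≤m+n (F (suc b)) 1)))
  Ft+v≡y : F t + v ≡ F (suc b) + 1
  Ft+v≡y = proj₂ (m≤n⇒∃[o]m+o≡n (≤-trans (<⇒≤ Ft<F) (m≤m+n (F (suc b)) 1)))
  y<x : F (suc b) + 1 < F (3 + b) + 1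
  y<x = +-monoˡ-< 1 (m<n+m (F (suc b)) (F-positive (2 + b)))
  v≢1 : v ≢ 1
  v≢1 = ≥2⇒≢1 (remainder-≥ Ft+v≡y (≤-trans (≤-reflexive (+-suc (F t) 1)) (+-monoˡ-≤ 1 Ft<F)))
  v<F : v < F (suc b)
  v<F = remainder-< Ft+v≡y (<-≤-trans (+-monoʳ-< (F (suc b)) (F-mono-≤ 2≤t)) (≤-reflexive (+-comm (F (suc b)) (F t))))
  s≡ : s ≡ F (2 + b) + v
  s≡ = cancel-inner (F t) (F (2 + b))
         (trans eq (trans (+-assoc (F (2 + b)) (F (suc b)) 1) (cong (F (2 + b) +_) (sym Ft+v≡y))))

summandBound-one : ∀ b → 2 ≤ t → t ≤ 2 + b → F t + s ≡ F (3 + b) + 1 →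
  SummandBoundBelow (F (3 + b) + 1) → greedySize (F (suc b) + 1) ≤ greedySize s
summandBound-one {t} {s} b 2≤t t≤2+b eq rec with m≤n⇒m<n∨m≡n t≤2+b
... | inj₂ refl =
  ≤-reflexive (cong greedySize (sym (+-cancelˡ-≡ (F (2 + b)) s _ (trans eq (+-assoc (F (2 + b)) (F (suc b)) 1)))))
... | inj₁ (s≤s t≤1+b) with m≤n⇒m<n∨m≡n t≤1+b
...   | inj₂ refl = subst (λ z → greedySize (F (suc b) + 1) ≤ greedySize z) (sym s≡) (greedySize-F+1-suc (suc b))
  where
  s≡ : s ≡ F (2 + b) + 1
  s≡ = +-cancelˡ-≡ (F (suc b)) s _ (trans eq (xy∙z≈y∙xz (F (2 + b)) (F (suc b)) 1))
...   | inj₁ (s≤s t≤b) = summandBound-one-below b 2≤t t≤b eq rec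

summandBound-below-≥ : ∀ a w → 2 ≤ t → t ≤ a → F t + w < F (suc a) →
  F t + s ≡ F (2 + a) + (F t + w) → SummandBound (F t + w) → greedySize (F t + w) ≤ greedySize s
summandBound-below-≥ zero _ (s≤s (s≤s _)) ()
summandBound-below-≥ {t} (suc b) w 2≤t t≤a u<F eq bound with cancel-inner (F t) (F (3 + b)) eq | w ≟ 1
... | refl | no w≢1 = begin
  greedySize (F t + w)       ≤⟨ bound t w 2≤t w≢1 refl ⟩
  suc (greedySize w)         ≡⟨ greedySize-F+ (suc b) (≤-<-trans (m≤n+m w (F t)) u<F) w≢1 ⟨
  greedySize (F (3 + b) + w) ∎
  where open ≤-Reasoning
... | refl | yes refl = begin
  greedySize (F t + 1)             ≤⟨ greedySize-F+1-mono t≤a ⟩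
  greedySize (F (suc b) + 1)       ≤⟨ n≤1+n _ ⟩
  suc (greedySize (F (suc b) + 1)) ≡⟨ greedySize-F+1 b ⟨
  greedySize (F (3 + b) + 1)       ∎
  where open ≤-Reasoning

summandBound-below-< : ∀ a → 2 ≤ t → t ≤ a → 2 ≤ u → u < F t → u < F (suc a) →
  F t + s ≡ F (2 + a) + u → SummandBoundBelow (F (2 + a) + u) → greedySize u ≤ greedySize s
summandBound-below-< zero (s≤s (s≤s _)) ()
summandBound-below-< {t} {u} {s} (suc b) 2≤t t≤a 2≤u u<Ft u<F eq rec = begin
  greedySize u               ≤⟨ greedySize-≤-F+ (suc b) 2≤u u<F (rec (m<n+m u (F-positive (3 + b)))) ⟩
  greedySize y               ≤⟨ rec y<x t v 2≤t v≢1 Ft+v≡y ⟩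
  suc (greedySize v)         ≡⟨ greedySize-F+ b v<F v≢1 ⟨
  greedySize (F (2 + b) + v) ≡⟨ cong greedySize s≡ ⟨
  greedySize s               ∎
  where
  open ≤-Reasoning
  y = F (suc b) + u
  Ft≤Fa : F t ≤ F (suc b)
  Ft≤Fa = F-mono-≤ t≤a
  v = proj₁ (m≤n⇒∃[o]m+o≡n (≤-trans Ft≤Fa (m≤m+n (F (suc b)) u)))
  Ft+v≡y : F t + v ≡ y
  Ft+v≡y = proj₂ (m≤n⇒∃[o]m+o≡n (≤-trans Ft≤Fa (m≤m+n (F (suc b)) u)))
  y<x : y < F (3 + b) + u
  y<x = +-monoˡ-< u (m<n+m (F (suc b)) (F-positive (2 + b)))
  v≢1 : v ≢ 1
  v≢1 = ≥2⇒≢1 (remainder-≥ Ft+v≡y (+-mono-≤ Ft≤Fa 2≤u))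
  v<F : v < F (suc b)
  v<F = remainder-< Ft+v≡y (<-≤-trans (+-monoʳ-< (F (suc b)) u<Ft) (≤-reflexive (+-comm (F (suc b)) (F t))))
  s≡ : s ≡ F (2 + b) + v
  s≡ = cancel-inner (F t) (F (2 + b))
         (trans eq (trans (+-assoc (F (2 + b)) (F (suc b)) u) (cong (F (2 + b) +_) (sym Ft+v≡y))))

summandBound-large : ∀ a → 2 ≤ t → t ≤ suc a → 2 ≤ u → u < F (suc a) →
  F t + s ≡ F (2 + a) + u → SummandBoundBelow (F (2 + a) + u) → greedySize u ≤ greedySize s
summandBound-large {t} {u} {s} a 2≤t t≤1+a 2≤u u<F eq rec with m≤n⇒m<n∨m≡n t≤1+a
... | inj₂ refl = subst (λ z → greedySize u ≤ greedySize z) (sym s≡) (greedySize-≤-F+ a 2≤u u<F (rec u<x))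
  where
  u<x : u < F (2 + a) + u
  u<x = m<n+m u (F-positive (2 + a))
  s≡ : s ≡ F a + u
  s≡ = +-cancelˡ-≡ (F (suc a)) s (F a + u) (trans eq (+-assoc (F (suc a)) (F a) u))
... | inj₁ (s≤s t≤a) with F t ≤? u
...   | no Ft≰u = summandBound-below-< a 2≤t t≤a 2≤u (≰⇒> Ft≰u) u<F eq rec
...   | yes Ft≤u with m≤n⇒∃[o]m+o≡n Ft≤u
...     | w , refl = summandBound-below-≥ a w 2≤t t≤a u<F eq (rec (m<n+m u (F-positive (2 + a))))

summandBound-leading : ∀ a u → u < F (suc a) → 2 ≤ t → t ≤ suc a →
  F t + s ≡ F (2 + a) + u → SummandBoundBelow (F (2 + a) + u) →
  greedySize (F (2 + a) + u) ≤ suc (greedySize s)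
summandBound-leading a zero u<F _ _ _ _ = ≤-trans (≤-reflexive (greedySize-F+ a u<F λ ())) (s≤s z≤n)
summandBound-leading zero (suc zero) (s≤s ()) _ _ _ _
summandBound-leading (suc b) (suc zero) _ 2≤t t≤1+a eq rec =
  ≤-trans (≤-reflexive (greedySize-F+1 b)) (s≤s (summandBound-one b 2≤t t≤1+a eq rec))
summandBound-leading a u@(suc (suc _)) u<F 2≤t t≤1+a eq rec =
  ≤-trans (≤-reflexive (greedySize-F+ a u<F λ ()))
          (s≤s (summandBound-large a 2≤t t≤1+a (s≤s (s≤s z≤n)) u<F eq rec))

summandBound : ∀ x → SummandBound x
summandBound = <-rec SummandBound step
  where
  Ft≤x : ∀ {x} t s → F t + s ≡ x → F t ≤ x
  Ft≤x t s refl = m≤m+n (F t) s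

  step : ∀ x → SummandBoundBelow x → SummandBound x
  step x rec t s 2≤t s≢1 eq with leadingForm (≤-trans (F-mono-≤ 2≤t) (Ft≤x t s eq))
  ... | leading a u u<F with m≤n⇒m<n∨m≡n (F-index-≤ t (Ft≤x t s eq) (+-monoʳ-< (F (2 + a)) u<F))
  ...   | inj₁ (s≤s t≤1+a) = summandBound-leading a u u<F 2≤t t≤1+a eq rec
  ...   | inj₂ refl with +-cancelˡ-≡ (F (2 + a)) s u eq
  ...     | refl = ≤-reflexive (greedySize-F+ a u<F s≢1)

sum-≢1 : ∀ {js} → All (2 ≤_) js → sum (map F js) ≢ 1
sum-≢1 [] ()
sum-≢1 (2≤t ∷ _) = ≥2⇒≢1 (≤-trans (F-mono-≤ 2≤t) (m≤m+n _ _))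

greedySize-minimal : ∀ {k} js → IsRep k js → greedySize k ≤ length js
greedySize-minimal [] (_ , refl) = z≤n
greedySize-minimal (t ∷ js) (2≤t ∷ all≥2 , refl) =
  ≤-trans (summandBound _ t (sum (map F js)) 2≤t (sum-≢1 all≥2) refl)
          (s≤s (greedySize-minimal js (all≥2 , refl)))

lemma9 : (k : ℕ) → 2 ≤ k →
    IsRep k (greedy k) × ((js : List ℕ) → IsRep k js → length (greedy k) ≤ length js)
lemma9 k 2≤k = greedy-isRep k (≥2⇒≢1 2≤k) , greedySize-minimal
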